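{- If a judgment $\Gamma^{\mathsf p}\rhd\delta\vdash\xi$ (or $\Gamma^{\mathsf p}\vdash\xi$) is derivable in the ptq type system, then its readback judgment is derivable in the typed calculus $\Lambda_\Box$.
   Context: The ptq-calculus. Intuitionistic types: $A::=X\mid A\to A$ ($X$ base types); for each $A$ there are types $A^{\mathsf p}$, $A^{\mathsf t}$, $A^{\mathsf q}$. Terms: p-variables $x,y,\dots$; a t-variable $k$; a constant $*$. p-terms $p::=x\mid\lambda\langle x,k\rangle.u\mid\lambda k.u$; t-terms $t::=*\mid k\mid\langle p,t\rangle\mid\lambda x.u$; q-terms $q::=\overline{\lambda}k.u$; e-terms $u::=t;p\mid q\,t$. $\lambda\langle x,k\rangle$ binds $x,k$; $\lambda k,\overline\lambda k$ bind $k$; $\lambda x$ binds $x$; terms modulo $\alpha$-conversion. A term is t-closed if it has no free t-variable; for $u$ with $k$ free, $u_*:=u[*/k]$ (similarly $t_*$). Typing: environments $\Gamma$ or $\Gamma\rhd\delta$, $\Gamma=x_1:A_1^{\mathsf p},\dots,x_n:A_n^{\mathsf p}$ (distinct variables), $\delta$ is $k:A^{\mathsf t}$ or $*:A^{\mathsf t}$. Rules: $\Gamma,x:A^{\mathsf p}\vdash x:A^{\mathsf p}$; $\Gamma\rhd k:A^{\mathsf t}\vdash k:A^{\mathsf t}$; $\Gamma\rhd *:A^{\mathsf t}\vdash *:A^{\mathsf t}$; from $\Gamma,x:A^{\mathsf p}\rhd k:B^{\mathsf t}\vdash u$ infer $\Gamma\vdash\lambda\langle x,k\rangle.u:(A\to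 B)^{\mathsf p}$; from $\Gamma\vdash p:A^{\mathsf p}$ and $\Gamma\rhd\delta\vdash t:B^{\mathsf t}$ infer $\Gamma\rhd\delta\vdash\langle p,t\rangle:(A\to B)^{\mathsf t}$; from $\Gamma\rhd k:A^{\mathsf t}\vdash u$ infer $\Gamma\vdash\lambda k.u:A^{\mathsf p}$; from $\Gamma,x:A^{\mathsf p}\rhd\delta\vdash u$ infer $\Gamma\rhd\delta\vdash\lambda x.u:A^{\mathsf t}$; from $\Gamma\rhd k:A^{\mathsf t}\vdash u$ infer $\Gamma\vdash\overline\lambda k.u:A^{\mathsf q}$; from $\Gamma\vdash p:A^{\mathsf p}$ and $\Gamma\rhd\delta\vdash t:A^{\mathsf t}$ infer $\Gamma\rhd\delta\vdash t;p$; from $\Gamma\vdash q:A^{\mathsf q}$ and $\Gamma\rhd\delta\vdash t:A^{\mathsf t}$ infer $\Gamma\rhd\delta\vdash q\,t$. $\Lambda_\Box$: simply typed $\lambda$-calculus over the same base types, whose variables are the p-variables, with for each type $A$ a constant $\Box^A:A$ (the hole); a term may contain several holes but all of the same type; a judgment $\Gamma,\Box:B\vdash M:A$ means $M$ has type $A$ in $\Gamma$ with its holes of type $B$. For $\Lambda_\Box$-terms, $M\cdot N:=M[N/\Box]$. Readback $\lfloor\cdot\rfloor$ (on t-closed t-terms, p-terms, q-terms, t-closed e-terms): $\lfloor *\rfloor=\Box$; $\lfloor x\rfloor=x$; $\lfloor\langle p,t_*\rangle\rfloor=\lfloor t_*\rfloor\cdot(\Box\,\lfloor p\rfloor)$;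 $\lfloor\lambda\langle x,k\rangle.u\rfloor=\lambda x.\lfloor u_*\rfloor$; $\lfloor\lambda x.u_*\rfloor=\lfloor u_*\rfloor[\Box/x]$; $\lfloor\lambda k.u\rfloor=\lfloor u_*\rfloor$; $\lfloor\overline\lambda k.u\rfloor=\lfloor u_*\rfloor$; $\lfloor t_*;p\rfloor=\lfloor t_*\rfloor\cdot\lfloor p\rfloor$; $\lfloor q\,t_*\rfloor=\lfloor t_*\rfloor\cdot\lfloor q\rfloor$. Readback of judgments, for $\Gamma=x_1:A_1,\dots,x_n:A_n$ and $\Gamma^{\mathsf p}=x_1:A_1^{\mathsf p},\dots,x_n:A_n^{\mathsf p}$: $\Gamma^{\mathsf p}\rhd k:A^{\mathsf t}\vdash t:B^{\mathsf t}\mapsto\Gamma,\Box:B\vdash\lfloor t_*\rfloor:A$; $\Gamma^{\mathsf p}\rhd *:A^{\mathsf t}\vdash t_*:B^{\mathsf t}\mapsto\Gamma,\Box:B\vdash\lfloor t_*\rfloor:A$; $\Gamma^{\mathsf p}\vdash p:A^{\mathsf p}\mapsto\Gamma\vdash\lfloor p\rfloor:A$; $\Gamma^{\mathsf p}\vdash q:A^{\mathsf q}\mapsto\Gamma\vdash\lfloor q\rfloor:A$; $\Gamma^{\mathsf p}\rhd k:A^{\mathsf t}\vdash u\mapsto\Gamma\vdash\lfloor u_*\rfloor:A$; $\Gamma^{\mathsf p}\rhd *:A^{\mathsf t}\vdash u_*\mapsto\Gamma\vdash\lfloor u_*\rfloor:A$. -}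

module Defs where

open import Data.Nat using (ℕ; zero; suc; _<ᵇ_)
open import Data.Bool using (if_then_else_)
open import Data.List using (List; []; _∷_)
open import Data.Maybe using (Maybe; just; nothing)

infixr 30 _⇒_
data Ty : Set where
  base : ℕ → Ty
  _⇒_  : Ty → Ty → Ty

-- Contexts Γ = x₁:A₁,…,xₙ:Aₙ ; de Bruijn: the head is the most recent
-- variable.  The same list Γ is used for Γ (in Λ_□) and Γᵖ (in ptq).
Ctx : Set
Ctx = List Ty

data _∋_∶_ : Ctx → ℕ → Ty → Set where
  here  : ∀ {Γ A} → (A ∷ Γ) ∋ zero ∶ A
  there : ∀ {Γ A B n} → Γ ∋ n ∶ A → (B ∷ Γ) ∋ suc n ∶ A

-- ptq-calculus syntax (p-variables as de Bruijn indices; there is a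
-- single t-variable k, so an occurrence of k refers to its nearest
-- binder λ⟨x,k⟩, λk or λ̄k).

data PTerm : Set
data TTerm : Set
data QTerm : Set
data ETerm : Set

data PTerm where
  pvar    : ℕ → PTerm
  lamPair : ETerm → PTerm          -- λ⟨x,k⟩.u   (binds x and k)
  lamK    : ETerm → PTerm          -- λk.u       (binds k)

data TTerm where
  star : TTerm
  kvar : TTerm
  pair : PTerm → TTerm → TTerm
  lamX : ETerm → TTerm             -- λx.u       (binds x)

data QTerm where
  qlam : ETerm → QTerm             -- λ̄k.u       (binds k)

data ETerm where
  _⨾_  : TTerm → PTerm → ETerm
  qapp : QTerm → TTerm → ETerm

subStarP : PTerm → PTerm
subStarT : TTerm → TTerm
subStarQ : QTerm → QTerm
subStarE : ETerm → ETerm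

subStarP (pvar x)    = pvar x
subStarP (lamPair u) = lamPair u
subStarP (lamK u)    = lamK u

subStarT star       = star
subStarT kvar       = star
subStarT (pair p t) = pair (subStarP p) (subStarT t)
subStarT (lamX u)   = lamX (subStarE u)

subStarQ (qlam u) = qlam u

subStarE (t ⨾ p)    = subStarT t ⨾ subStarP p
subStarE (qapp q t) = qapp (subStarQ q) (subStarT t)

data Delta : Set where
  kδ    : Ty → Delta
  starδ : Ty → Delta

data _⊢p_∶_ : Ctx → PTerm → Ty → Set
data _▷_⊢t_∶_ : Ctx → Delta → TTerm → Ty → Set
data _⊢q_∶_ : Ctx → QTerm → Ty → Set
data _▷_⊢e_ : Ctx → Delta → ETerm → Set

data _⊢p_∶_ where
  ax-x    : ∀ {Γ x A} → Γ ∋ x ∶ A → Γ ⊢p pvar x ∶ A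
  ⊢lamPair : ∀ {Γ A B u} → (A ∷ Γ) ▷ kδ B ⊢e u → Γ ⊢p lamPair u ∶ (A ⇒ B)
  ⊢lamK   : ∀ {Γ A u} → Γ ▷ kδ A ⊢e u → Γ ⊢p lamK u ∶ A

data _▷_⊢t_∶_ where
  ax-k    : ∀ {Γ A} → Γ ▷ kδ A ⊢t kvar ∶ A
  ax-*    : ∀ {Γ A} → Γ ▷ starδ A ⊢t star ∶ A
  ⊢pair   : ∀ {Γ δ A B p t} → Γ ⊢p p ∶ A → Γ ▷ δ ⊢t t ∶ B →
            Γ ▷ δ ⊢t pair p t ∶ (A ⇒ B)
  ⊢lamX   : ∀ {Γ δ A u} → (A ∷ Γ) ▷ δ ⊢e u → Γ ▷ δ ⊢t lamX u ∶ A

data _⊢q_∶_ where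
  ⊢qlam : ∀ {Γ A u} → Γ ▷ kδ A ⊢e u → Γ ⊢q qlam u ∶ A

data _▷_⊢e_ where
  ⊢seq  : ∀ {Γ δ A p t} → Γ ⊢p p ∶ A → Γ ▷ δ ⊢t t ∶ A → Γ ▷ δ ⊢e (t ⨾ p)
  ⊢qapp : ∀ {Γ δ A q t} → Γ ⊢q q ∶ A → Γ ▷ δ ⊢t t ∶ A → Γ ▷ δ ⊢e qapp q t

data Tm : Set where
  var  : ℕ → Tm
  lam  : Tm → Tm
  app  : Tm → Tm → Tm
  hole : Tm

-- Typing.  The hole annotation is  just B  for  Γ, □:B ⊢ M : A  and
-- nothing for a plain judgment  Γ ⊢ M : A  (no holes).
data _⨾_⊢_∶_ : Ctx → Maybe Ty → Tm → Ty → Set where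
  ⊢var  : ∀ {Γ h x A} → Γ ∋ x ∶ A → Γ ⨾ h ⊢ var x ∶ A
  ⊢lam  : ∀ {Γ h A B M} → (A ∷ Γ) ⨾ h ⊢ M ∶ B → Γ ⨾ h ⊢ lam M ∶ (A ⇒ B)
  ⊢app  : ∀ {Γ h A B M N} → Γ ⨾ h ⊢ M ∶ (A ⇒ B) → Γ ⨾ h ⊢ N ∶ A →
          Γ ⨾ h ⊢ app M N ∶ B
  ⊢hole : ∀ {Γ B} → Γ ⨾ just B ⊢ hole ∶ B

shift : ℕ → Tm → Tm
shift c (var n)   = if n <ᵇ c then var n else var (suc n)
shift c (lam M)   = lam (shift (suc c) M)
shift c (app M N) = app (shift c M) (shift c N)
shift c hole      = hole

fill : Tm → Tm → Tm
fill (var n)   N = var n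
fill (lam M)   N = lam (fill M (shift zero N))
fill (app M L) N = app (fill M N) (fill L N)
fill hole      N = N

_·_ : Tm → Tm → Tm
M · N = fill M N

-- M[□/x] where x is the variable with index d (indices above d go down)
holeVar : ℕ → ℕ → Tm
holeVar zero    zero    = hole
holeVar zero    (suc n) = var n
holeVar (suc d) zero    = var zero
holeVar (suc d) (suc n) = shift zero (holeVar d n)

holeFor : ℕ → Tm → Tm
holeFor d (var n)   = holeVar d n
holeFor d (lam M)   = lam (holeFor (suc d) M)
holeFor d (app M N) = app (holeFor d M) (holeFor d N)
holeFor d hole      = hole

-- The paper defines ⌊·⌋ on t-closed terms; we extend it to
-- all terms by ⌊k⌋ = □, so that ⌊ξ⌋ = ⌊ξ_*⌋ and the paper's clauses
-- (e.g. ⌊λ⟨x,k⟩.u⌋ = λx.⌊u_*⌋) hold literally on t-closed terms.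

⌊_⌋p : PTerm → Tm
⌊_⌋t : TTerm → Tm
⌊_⌋q : QTerm → Tm
⌊_⌋e : ETerm → Tm

⌊ pvar x ⌋p    = var x
⌊ lamPair u ⌋p = lam ⌊ u ⌋e
⌊ lamK u ⌋p    = ⌊ u ⌋e

⌊ star ⌋t     = hole
⌊ kvar ⌋t     = hole
⌊ pair p t ⌋t = ⌊ t ⌋t · app hole ⌊ p ⌋p
⌊ lamX u ⌋t   = holeFor zero ⌊ u ⌋e

⌊ qlam u ⌋q = ⌊ u ⌋e

⌊ t ⨾ p ⌋e    = ⌊ t ⌋t · ⌊ p ⌋p
⌊ qapp q t ⌋e = ⌊ t ⌋t · ⌊ q ⌋q

module Submission where

open import Defs
open import Data.Product using (_×_; _,_)
open import Data.Maybe using (just; nothing)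
open import Data.Nat using (_<ᵇ_)
open import Data.Bool using (true; false)
open import Data.List using ([]; _∷_; _++_; length)

-- Readback sends a typed t-term to a one-hole context whose hole has the type of
-- the t-term and whose result has the type of its continuation variable; e-terms
-- fill that hole with a p- or q-term of the matching type. Soundness is then
-- mutual induction on derivations, using that plugging (M · N) and abstraction of
-- a variable into the hole (M[□/x]) preserve typing in Λ_□. The k-judgments reduce
-- to the *-judgments because u ↦ u_* turns k : Aᵗ into * : Aᵗ.

shift-var : ∀ Δ {Γ C h n A} → (Δ ++ Γ) ∋ n ∶ A →
            (Δ ++ C ∷ Γ) ⨾ h ⊢ shift (length Δ) (var n) ∶ A
shift-var []      x         = ⊢var (there x)
shift-var (_ ∷ _) here      = ⊢var here
shift-var (_ ∷ Δ) {C = C} {h} (there {n = m} x)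
  with m <ᵇ length Δ | shift-var Δ {C = C} {h} x
... | true  | ⊢var y = ⊢var (there y)
... | false | ⊢var y = ⊢var (there y)

⊢-shift : ∀ Δ {Γ C h M A} → (Δ ++ Γ) ⨾ h ⊢ M ∶ A →
          (Δ ++ C ∷ Γ) ⨾ h ⊢ shift (length Δ) M ∶ A
⊢-shift Δ (⊢var x)         = shift-var Δ x
⊢-shift Δ (⊢lam {A = A} M) = ⊢lam (⊢-shift (A ∷ Δ) M)
⊢-shift Δ (⊢app M N)       = ⊢app (⊢-shift Δ M) (⊢-shift Δ N)
⊢-shift Δ ⊢hole            = ⊢hole

⊢-anyHole : ∀ {Γ h M A} → Γ ⨾ nothing ⊢ M ∶ A → Γ ⨾ h ⊢ M ∶ A
⊢-anyHole (⊢var x)   = ⊢var x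
⊢-anyHole (⊢lam M)   = ⊢lam (⊢-anyHole M)
⊢-anyHole (⊢app M N) = ⊢app (⊢-anyHole M) (⊢-anyHole N)

⊢-fill : ∀ {Γ h B M N A} → Γ ⨾ just B ⊢ M ∶ A → Γ ⨾ h ⊢ N ∶ B →
         Γ ⨾ h ⊢ M · N ∶ A
⊢-fill (⊢var x)   N = ⊢var x
⊢-fill (⊢lam M)   N = ⊢lam (⊢-fill M (⊢-shift [] N))
⊢-fill (⊢app M L) N = ⊢app (⊢-fill M N) (⊢-fill L N)
⊢-fill ⊢hole      N = N

holeVar-typed : ∀ Δ {Γ A n C} → (Δ ++ A ∷ Γ) ∋ n ∶ C →
                (Δ ++ Γ) ⨾ just A ⊢ holeVar (length Δ) n ∶ C
holeVar-typed []      here      = ⊢hole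
holeVar-typed []      (there x) = ⊢var x
holeVar-typed (_ ∷ _) here      = ⊢var here
holeVar-typed (_ ∷ Δ) (there x) = ⊢-shift [] (holeVar-typed Δ x)

⊢-holeFor : ∀ Δ {Γ A M C} → (Δ ++ A ∷ Γ) ⨾ nothing ⊢ M ∶ C →
            (Δ ++ Γ) ⨾ just A ⊢ holeFor (length Δ) M ∶ C
⊢-holeFor Δ (⊢var x)         = holeVar-typed Δ x
⊢-holeFor Δ (⊢lam {A = A} M) = ⊢lam (⊢-holeFor (A ∷ Δ) M)
⊢-holeFor Δ (⊢app M N)       = ⊢app (⊢-holeFor Δ M) (⊢-holeFor Δ N)

⊢p-subStar : ∀ {Γ p A} → Γ ⊢p p ∶ A → Γ ⊢p subStarP p ∶ A
⊢p-subStar (ax-x x)     = ax-x x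
⊢p-subStar (⊢lamPair u) = ⊢lamPair u
⊢p-subStar (⊢lamK u)    = ⊢lamK u

⊢t-subStar : ∀ {Γ A B t} → Γ ▷ kδ A ⊢t t ∶ B → Γ ▷ starδ A ⊢t subStarT t ∶ B
⊢e-subStar : ∀ {Γ A u} → Γ ▷ kδ A ⊢e u → Γ ▷ starδ A ⊢e subStarE u

⊢t-subStar ax-k        = ax-*
⊢t-subStar (⊢pair p t) = ⊢pair (⊢p-subStar p) (⊢t-subStar t)
⊢t-subStar (⊢lamX u)   = ⊢lamX (⊢e-subStar u)

⊢e-subStar (⊢seq p t)          = ⊢seq (⊢p-subStar p) (⊢t-subStar t)
⊢e-subStar (⊢qapp (⊢qlam u) t) = ⊢qapp (⊢qlam u) (⊢t-subStar t)

typeOf : Delta → Ty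
typeOf (kδ A)    = A
typeOf (starδ A) = A

readback-t : ∀ {Γ δ t B} → Γ ▷ δ ⊢t t ∶ B → Γ ⨾ just B ⊢ ⌊ t ⌋t ∶ typeOf δ
readback-p : ∀ {Γ p A} → Γ ⊢p p ∶ A → Γ ⨾ nothing ⊢ ⌊ p ⌋p ∶ A
readback-q : ∀ {Γ q A} → Γ ⊢q q ∶ A → Γ ⨾ nothing ⊢ ⌊ q ⌋q ∶ A
readback-e : ∀ {Γ δ u} → Γ ▷ δ ⊢e u → Γ ⨾ nothing ⊢ ⌊ u ⌋e ∶ typeOf δ

readback-t ax-k        = ⊢hole
readback-t ax-*        = ⊢hole
readback-t (⊢pair p t) = ⊢-fill (readback-t t) (⊢app ⊢hole (⊢-anyHole (readback-p p)))
readback-t (⊢lamX u)   = ⊢-holeFor [] (readback-e u)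

readback-p (ax-x x)     = ⊢var x
readback-p (⊢lamPair u) = ⊢lam (readback-e u)
readback-p (⊢lamK u)    = readback-e u

readback-q (⊢qlam u) = readback-e u

readback-e (⊢seq p t)  = ⊢-fill (readback-t t) (readback-p p)
readback-e (⊢qapp q t) = ⊢-fill (readback-t t) (readback-q q)

proposition3 :
    (∀ {Γ A B t} → Γ ▷ kδ A ⊢t t ∶ B → Γ ⨾ just B ⊢ ⌊ subStarT t ⌋t ∶ A)
    × (∀ {Γ A B t} → Γ ▷ starδ A ⊢t t ∶ B → Γ ⨾ just B ⊢ ⌊ t ⌋t ∶ A)
    × (∀ {Γ A p} → Γ ⊢p p ∶ A → Γ ⨾ nothing ⊢ ⌊ p ⌋p ∶ A)
    × (∀ {Γ A q} → Γ ⊢q q ∶ A → Γ ⨾ nothing ⊢ ⌊ q ⌋q ∶ A)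
    × (∀ {Γ A u} → Γ ▷ kδ A ⊢e u → Γ ⨾ nothing ⊢ ⌊ subStarE u ⌋e ∶ A)
    × (∀ {Γ A u} → Γ ▷ starδ A ⊢e u → Γ ⨾ nothing ⊢ ⌊ u ⌋e ∶ A)
proposition3 =
    (λ t → readback-t (⊢t-subStar t))
  , readback-t
  , readback-p
  , readback-q
  , (λ u → readback-e (⊢e-subStar u))
  , readback-e
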